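{- Let $G$ be a connected multigraph, $T$ a spanning tree of $G$, and suppose $\mathrm{cover}$ is a function assigning to every edge $f\in E(T)$ an edge $\mathrm{cover}(f)\in E(G)\setminus E(T)$ that covers $f$ in $T$. Let $e\in E(T)$ and $e'=\mathrm{cover}(e)$. Perform a swap on $e$: let $T'$ be obtained from $T$ by removing $e$ and adding $e'$, and define $\mathrm{cover}'$ on $E(T')$ by $\mathrm{cover}'(f)=e$ for every edge $f\in E(T')$ covered by $e$ in $T'$, and $\mathrm{cover}'(f)=\mathrm{cover}(f)$ for every other edge $f\in E(T')$. Then $T'$ is a spanning tree of $G$ and, for every $f\in E(T')$, $\mathrm{cover}'(f)$ is an edge of $E(G)\setminus E(T')$ that covers $f$ in $T'$.
   Context: Multigraphs may contain loops and parallel edges; $E(\cdot)$ denotes the multiset of edges. Given a spanning tree $T$ of $G$, an edge $g\in E(G)\setminus E(T)$ covers an edge $f\in E(T)$ (in $T$) if $f$ lies on the unique path in $T$ connecting the two endpoints of $g$. -}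

module Defs where

open import Data.Nat using (ℕ)
open import Data.Fin using (Fin)
open import Data.Fin.Subset using (Subset; _∈_; _∉_; _-_; _∪_; ⁅_⁆)
open import Data.List using (List; []; _∷_)
open import Data.List.Relation.Unary.Unique.Propositional using (Unique)
import Data.List.Membership.Propositional as LMem
open import Data.Product using (_×_; _,_; proj₁; proj₂; Σ; ∃)
open import Data.Sum using (_⊎_)
open import Relation.Binary.PropositionalEquality using (_≡_)
open import Relation.Nullary using (¬_)

-- A finite multigraph: vertices Fin n, edges Fin m (so parallel edges are
-- distinct edge indices), each edge has an (unordered) pair of endpoints
-- given as an ordered pair; loops are edges with equal endpoints.
record Multigraph : Set where
  field
    n    : ℕ
    m    : ℕ
    ends : Fin m → Fin n × Fin n

module _ (G : Multigraph) where
  open Multigraph G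

  EdgeSet : Set
  EdgeSet = Subset m

  Joins : Fin m → Fin n → Fin n → Set
  Joins e u w = (ends e ≡ (u , w)) ⊎ (ends e ≡ (w , u))

  data Walk (S : EdgeSet) : Fin n → Fin n → Set where
    []  : ∀ {u} → Walk S u u
    _∷⟨_,_⟩_ : ∀ {u w v} (e : Fin m) → e ∈ S → Joins e u w → Walk S w v → Walk S u v

  walkEdges : ∀ {S u v} → Walk S u v → List (Fin m)
  walkEdges [] = []
  walkEdges (e ∷⟨ _ , _ ⟩ p) = e ∷ walkEdges p

  walkTargets : ∀ {S u v} → Walk S u v → List (Fin n)
  walkTargets [] = []
  walkTargets (_∷⟨_,_⟩_ {w = w} e _ _ p) = w ∷ walkTargets p

  IsPath : ∀ {S u v} → Walk S u v → Set
  IsPath {u = u} p = Unique (u ∷ walkTargets p)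

  -- a cycle: a nonempty closed walk with pairwise distinct edges whose
  -- vertices (other than the repeated start/end) are pairwise distinct.
  -- (Covers loops (length 1) and pairs of parallel edges (length 2).)
  IsCycle : ∀ {S u} → Walk S u u → Set
  IsCycle [] = ⊥'
    where open import Data.Empty renaming (⊥ to ⊥')
  IsCycle p@(_ ∷⟨ _ , _ ⟩ _) = Unique (walkEdges p) × Unique (walkTargets p)

  Connected : EdgeSet → Set
  Connected S = (u v : Fin n) → Walk S u v

  Acyclic : EdgeSet → Set
  Acyclic S = ∀ {u} (p : Walk S u u) → ¬ IsCycle p

  IsSpanningTree : EdgeSet → Set
  IsSpanningTree T = Connected T × Acyclic T

  allEdges : EdgeSet
  allEdges = Data.Fin.Subset.⊤
    where import Data.Fin.Subset

  IsConnectedMultigraph : Set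
  IsConnectedMultigraph = Connected allEdges

  OnTreePath : EdgeSet → Fin m → Fin m → Set
  OnTreePath T g f =
    Σ (Walk T (proj₁ (ends g)) (proj₂ (ends g))) λ p → IsPath p × f LMem.∈ walkEdges p

  Covers : EdgeSet → Fin m → Fin m → Set
  Covers T g f = g ∉ T × f ∈ T × OnTreePath T g f

  swapTree : EdgeSet → Fin m → Fin m → EdgeSet
  swapTree T e e' = (T - e) ∪ ⁅ e' ⁆

-- Let P be the path of T joining the ends of e′ = cover e; it runs through e.
-- Replacing e on P by e′ gives a path of T′ joining the ends of e (the bypass),
-- so T′ is connected; a cycle of T′ avoiding e′ lies in T, and one through e′
-- yields a walk joining the ends of e′ in T - e, which is impossible because in
-- an acyclic edge set each edge of a path separates the ends of that path.
-- In T′ the edge e covers exactly the edges of the bypass. Any other edge f of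
-- T′ is off P, so trading e′ for P turns walks of T′ - f into walks of T - f,
-- where f still separates the ends of cover f: hence cover f covers f in T′.
module Submission where

open import Defs
open import Function using (_∘_)
open import Data.Fin using (Fin; _≟_)
open import Data.Fin.Subset using (Subset; _∈_; _∉_; _-_; _─_; ⁅_⁆; inside; outside)
open import Data.Fin.Subset.Properties
  using (x∈p∪q⁻; x∈p∪q⁺; x∈⁅x⁆; x∈⁅y⁆⇒x≡y; p─q⊆p; x∈p∧x≢y⇒x∈p-y)
open import Data.Vec.Base using (_∷_; here; there)
open import Data.List using (List; _∷_; _++_; _∷ʳ_)
import Data.List.Relation.Unary.All as All
open import Data.List.Relation.Unary.Any using (here; there; any?)
open import Data.List.Relation.Unary.AllPairs using ([]; _∷_)
open import Data.List.Relation.Unary.Unique.Propositional using (Unique)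
open import Data.List.Relation.Unary.Unique.Propositional.Properties using (Unique[x∷xs]⇒x∉xs)
import Data.List.Relation.Binary.Permutation.Setoid.Properties as SetoidPermutation
open import Data.List.Relation.Binary.Permutation.Propositional
  using (_↭_; ↭-refl; ↭-sym; ↭-prep; ↭⇒↭ₛ; module PermutationReasoning)
open import Data.List.Relation.Binary.Permutation.Propositional.Properties
  using (∈-resp-↭; ++⁺; ∷↭∷ʳ; shift)
open import Data.List.Membership.Propositional using () renaming (_∈_ to _∈ₗ_; _∉_ to _∉ₗ_)
open import Data.List.Membership.Propositional.Properties using (∈-++⁺ˡ; ∈-++⁺ʳ; ∈-++⁻)
open import Data.Product using (Σ-syntax; _×_; _,_; proj₁; proj₂)
open import Data.Sum using (_⊎_; inj₁; inj₂)
open import Relation.Nullary using (¬_; Dec; yes; no; contradiction)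
open import Relation.Binary.PropositionalEquality
  using (_≡_; _≢_; refl; sym; trans; cong; cong₂; subst)
open import Relation.Binary.PropositionalEquality.Properties using (setoid)

unique-resp-↭ : {A : Set} {xs ys : List A} → xs ↭ ys → Unique xs → Unique ys
unique-resp-↭ {A} σ = SetoidPermutation.Unique-resp-↭ (setoid A) (↭⇒↭ₛ σ)

_∈ₗ?_ : ∀ {k} (x : Fin k) (xs : List (Fin k)) → Dec (x ∈ₗ xs)
x ∈ₗ? xs = any? (x ≟_) xs

x∈p─q⇒x∉q : ∀ {k} {x : Fin k} (p q : Subset k) → x ∈ p ─ q → x ∉ q
x∈p─q⇒x∉q (inside ∷ p) (outside ∷ q) here ()
x∈p─q⇒x∉q (_ ∷ p) (_ ∷ q) (there x∈p─q) (there x∈q) = x∈p─q⇒x∉q p q x∈p─q x∈q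

x∈p-y⇒x≢y : ∀ {k} {x y : Fin k} {p : Subset k} → x ∈ p - y → x ≢ y
x∈p-y⇒x≢y {y = y} {p} x∈p-y refl = x∈p─q⇒x∉q p ⁅ y ⁆ x∈p-y (x∈⁅x⁆ y)

x∈p-y⇒x∈p : ∀ {k} {x y : Fin k} {p : Subset k} → x ∈ p - y → x ∈ p
x∈p-y⇒x∈p {y = y} {p} = p─q⊆p p ⁅ y ⁆

module Walks (G : Multigraph) where
  open Multigraph G

  private variable
    S S′ : EdgeSet G
    u v w x y : Fin n
    f g h : Fin m

  vertices : Walk G S u v → List (Fin n)
  vertices {u = u} p = u ∷ walkTargets G p

  joins-ends : ∀ g → Joins G g (proj₁ (ends g)) (proj₂ (ends g))
  joins-ends g = inj₁ refl

  joins-sym : Joins G g u w → Joins G g w u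
  joins-sym (inj₁ eq) = inj₂ eq
  joins-sym (inj₂ eq) = inj₁ eq

  joins-unique : Joins G g u w → Joins G g x y → (u ≡ x × w ≡ y) ⊎ (u ≡ y × w ≡ x)
  joins-unique (inj₁ eq) (inj₁ eq′) with trans (sym eq) eq′
  ... | refl = inj₁ (refl , refl)
  joins-unique (inj₁ eq) (inj₂ eq′) with trans (sym eq) eq′
  ... | refl = inj₂ (refl , refl)
  joins-unique (inj₂ eq) (inj₁ eq′) with trans (sym eq) eq′
  ... | refl = inj₂ (refl , refl)
  joins-unique (inj₂ eq) (inj₂ eq′) with trans (sym eq) eq′
  ... | refl = inj₁ (refl , refl)

  walkEdge∈ : (p : Walk G S u v) → g ∈ₗ walkEdges G p → g ∈ S
  walkEdge∈ (_ ∷⟨ g∈S , _ ⟩ _) (here refl) = g∈S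
  walkEdge∈ (_ ∷⟨ _ , _ ⟩ p) (there g∈p) = walkEdge∈ p g∈p

  infixr 5 _++ʷ_
  _++ʷ_ : Walk G S u v → Walk G S v w → Walk G S u w
  [] ++ʷ q = q
  (g ∷⟨ g∈S , j ⟩ p) ++ʷ q = g ∷⟨ g∈S , j ⟩ (p ++ʷ q)

  edges-++ʷ : (p : Walk G S u v) (q : Walk G S v w) →
              walkEdges G (p ++ʷ q) ≡ walkEdges G p ++ walkEdges G q
  edges-++ʷ [] q = refl
  edges-++ʷ (g ∷⟨ _ , _ ⟩ p) q = cong (g ∷_) (edges-++ʷ p q)

  targets-++ʷ : (p : Walk G S u v) (q : Walk G S v w) →
                walkTargets G (p ++ʷ q) ≡ walkTargets G p ++ walkTargets G q
  targets-++ʷ [] q = refl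
  targets-++ʷ (_∷⟨_,_⟩_ {w = w} _ _ _ p) q = cong (w ∷_) (targets-++ʷ p q)

  reverseʷ : Walk G S u v → Walk G S v u
  reverseʷ [] = []
  reverseʷ (g ∷⟨ g∈S , j ⟩ p) = reverseʷ p ++ʷ g ∷⟨ g∈S , joins-sym j ⟩ []

  edges-reverseʷ : (p : Walk G S u v) → walkEdges G (reverseʷ p) ↭ walkEdges G p
  edges-reverseʷ [] = ↭-refl
  edges-reverseʷ (g ∷⟨ g∈S , j ⟩ p) = begin
    walkEdges G (reverseʷ p ++ʷ g ∷⟨ g∈S , joins-sym j ⟩ [])
      ≡⟨ edges-++ʷ (reverseʷ p) _ ⟩
    walkEdges G (reverseʷ p) ∷ʳ g   ↭⟨ ∷↭∷ʳ g _ ⟨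
    g ∷ walkEdges G (reverseʷ p)    ↭⟨ ↭-prep g (edges-reverseʷ p) ⟩
    g ∷ walkEdges G p               ∎
    where open PermutationReasoning

  vertices-reverseʷ : (p : Walk G S u v) → vertices (reverseʷ p) ↭ vertices p
  vertices-reverseʷ [] = ↭-refl
  vertices-reverseʷ {u = u} {v = v} (g ∷⟨ g∈S , j ⟩ p) = begin
    v ∷ walkTargets G (reverseʷ p ++ʷ g ∷⟨ g∈S , joins-sym j ⟩ [])
      ≡⟨ cong (v ∷_) (targets-++ʷ (reverseʷ p) _) ⟩
    vertices (reverseʷ p) ∷ʳ u      ↭⟨ ∷↭∷ʳ u _ ⟨
    u ∷ vertices (reverseʷ p)       ↭⟨ ↭-prep u (vertices-reverseʷ p) ⟩
    u ∷ vertices p                  ∎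
    where open PermutationReasoning

  reverseʷ-isPath : (p : Walk G S u v) → IsPath G p → IsPath G (reverseʷ p)
  reverseʷ-isPath p = unique-resp-↭ (↭-sym (vertices-reverseʷ p))

  realign : Joins G g u w → Joins G g x y → Walk G S u w → Walk G S x y
  realign j j′ p with joins-unique j j′
  ... | inj₁ (refl , refl) = p
  ... | inj₂ (refl , refl) = reverseʷ p

  realign-edges : (j : Joins G g u w) (j′ : Joins G g x y) (p : Walk G S u w) →
                  walkEdges G (realign j j′ p) ↭ walkEdges G p
  realign-edges j j′ p with joins-unique j j′
  ... | inj₁ (refl , refl) = ↭-refl
  ... | inj₂ (refl , refl) = edges-reverseʷ p

  realign-vertices : (j : Joins G g u w) (j′ : Joins G g x y) (p : Walk G S u w) →
                     vertices (realign j j′ p) ↭ vertices p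
  realign-vertices j j′ p with joins-unique j j′
  ... | inj₁ (refl , refl) = ↭-refl
  ... | inj₂ (refl , refl) = vertices-reverseʷ p

  restrict : (p : Walk G S u v) → (∀ {g} → g ∈ₗ walkEdges G p → g ∈ S′) → Walk G S′ u v
  restrict [] _ = []
  restrict (g ∷⟨ _ , j ⟩ p) p⊆S′ = g ∷⟨ p⊆S′ (here refl) , j ⟩ restrict p (p⊆S′ ∘ there)

  restrict-edges : (p : Walk G S u v) (p⊆S′ : ∀ {g} → g ∈ₗ walkEdges G p → g ∈ S′) →
                   walkEdges G (restrict p p⊆S′) ≡ walkEdges G p
  restrict-edges [] _ = refl
  restrict-edges (g ∷⟨ _ , _ ⟩ p) p⊆S′ = cong (g ∷_) (restrict-edges p (p⊆S′ ∘ there))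

  restrict-targets : (p : Walk G S u v) (p⊆S′ : ∀ {g} → g ∈ₗ walkEdges G p → g ∈ S′) →
                     walkTargets G (restrict p p⊆S′) ≡ walkTargets G p
  restrict-targets [] _ = refl
  restrict-targets (_∷⟨_,_⟩_ {w = w} _ _ _ p) p⊆S′ = cong (w ∷_) (restrict-targets p (p⊆S′ ∘ there))

  restrict-isCycle : (p : Walk G S u u) (p⊆S′ : ∀ {g} → g ∈ₗ walkEdges G p → g ∈ S′) →
                     IsCycle G p → IsCycle G (restrict p p⊆S′)
  restrict-isCycle p@(_ ∷⟨ _ , _ ⟩ _) p⊆S′ (edges-unique , targets-unique) =
    subst Unique (sym (restrict-edges p p⊆S′)) edges-unique ,
    subst Unique (sym (restrict-targets p p⊆S′)) targets-unique

  avoid : (p : Walk G S u v) → f ∉ₗ walkEdges G p → Walk G (S - f) u v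
  avoid p f∉p = restrict p λ g∈p →
    x∈p∧x≢y⇒x∈p-y (walkEdge∈ p g∈p) λ { refl → f∉p g∈p }

  ends∈vertices : (p : Walk G S u v) → g ∈ₗ walkEdges G p →
                  proj₁ (ends g) ∈ₗ vertices p × proj₂ (ends g) ∈ₗ vertices p
  ends∈vertices (_ ∷⟨ _ , inj₁ eq ⟩ _) (here refl) = here (cong proj₁ eq) , there (here (cong proj₂ eq))
  ends∈vertices (_ ∷⟨ _ , inj₂ eq ⟩ _) (here refl) = there (here (cong proj₁ eq)) , here (cong proj₂ eq)
  ends∈vertices (_ ∷⟨ _ , _ ⟩ p) (there g∈p) with ends∈vertices p g∈p
  ... | end₁∈ , end₂∈ = there end₁∈ , there end₂∈

  joined∈ : {xs : List (Fin n)} → Joins G g u w →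
            proj₁ (ends g) ∈ₗ xs → proj₂ (ends g) ∈ₗ xs → u ∈ₗ xs
  joined∈ (inj₁ eq) end₁∈ _ = subst (_∈ₗ _) (cong proj₁ eq) end₁∈
  joined∈ (inj₂ eq) _ end₂∈ = subst (_∈ₗ _) (cong proj₂ eq) end₂∈

  -- Every later edge has both ends among the later vertices, which exclude the
  -- start u, whereas the first edge has u as an end.
  isPath⇒edges-unique : (p : Walk G S u v) → IsPath G p → Unique (walkEdges G p)
  isPath⇒edges-unique [] _ = []
  isPath⇒edges-unique (g ∷⟨ _ , j ⟩ p) (u∉p ∷ p-isPath) =
    All.tabulate (λ { g∈p refl → All.lookup u∉p (joined∈ j (proj₁ (ends∈vertices p g∈p))
                                                           (proj₂ (ends∈vertices p g∈p))) refl })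
    ∷ isPath⇒edges-unique p p-isPath

  record Split (f : Fin m) (p : Walk G S u v) : Set where
    constructor split
    field
      {s t}         : Fin n
      before        : Walk G S u s
      f∈S           : f ∈ S
      joins         : Joins G f s t
      after         : Walk G S t v
      decomposition : p ≡ before ++ʷ f ∷⟨ f∈S , joins ⟩ after

    edges-split : walkEdges G p ↭ f ∷ walkEdges G before ++ walkEdges G after
    edges-split = begin
      walkEdges G p                                                ≡⟨ cong (walkEdges G) decomposition ⟩
      walkEdges G (before ++ʷ f ∷⟨ f∈S , joins ⟩ after)            ≡⟨ edges-++ʷ before _ ⟩
      walkEdges G before ++ f ∷ walkEdges G after                  ↭⟨ shift f (walkEdges G before) _ ⟩
      f ∷ walkEdges G before ++ walkEdges G after                  ∎
      where open PermutationReasoning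

    vertices-split : vertices p ≡ vertices before ++ vertices after
    vertices-split = trans (cong vertices decomposition) (cong (u ∷_) (targets-++ʷ before _))

    f∉before×after : Unique (walkEdges G p) → f ∉ₗ walkEdges G before × f ∉ₗ walkEdges G after
    f∉before×after p-unique =
      f∉rest ∘ ∈-++⁺ˡ , f∉rest ∘ ∈-++⁺ʳ (walkEdges G before)
      where f∉rest = Unique[x∷xs]⇒x∉xs (unique-resp-↭ edges-split p-unique)

  splitAt : (p : Walk G S u v) → f ∈ₗ walkEdges G p → Split f p
  splitAt (_ ∷⟨ g∈S , j ⟩ p) (here refl) = split [] g∈S j p refl
  splitAt (g ∷⟨ g∈S , j ⟩ p) (there f∈p) with splitAt p f∈p
  ... | split before f∈S joins after refl = split (g ∷⟨ g∈S , j ⟩ before) f∈S joins after refl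

  dropUntil : (q : Walk G S w v) → IsPath G q → u ∈ₗ vertices q → Σ[ r ∈ Walk G S u v ] IsPath G r
  dropUntil q q-isPath (here refl) = q , q-isPath
  dropUntil (_ ∷⟨ _ , _ ⟩ q) (_ ∷ q-isPath) (there u∈q) = dropUntil q q-isPath u∈q

  toPath : Walk G S u v → Σ[ q ∈ Walk G S u v ] IsPath G q
  toPath [] = [] , (All.[] ∷ [])
  toPath {u = u} (g ∷⟨ g∈S , j ⟩ p) with toPath p
  ... | q , q-isPath with u ∈ₗ? vertices q
  ...   | yes u∈q = dropUntil q q-isPath u∈q
  ...   | no u∉q  = g ∷⟨ g∈S , j ⟩ q , All.tabulate (λ { u∈q refl → u∉q u∈q }) ∷ q-isPath

  reroute : Walk G S′ (proj₁ (ends h)) (proj₂ (ends h)) → (∀ {g} → g ∈ S → g ≢ h → g ∈ S′) →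
            Walk G S u v → Walk G S′ u v
  reroute b S-h⊆S′ [] = []
  reroute {h = h} b S-h⊆S′ (g ∷⟨ g∈S , j ⟩ p) with g ≟ h
  ... | yes refl = realign (joins-ends g) j b ++ʷ reroute b S-h⊆S′ p
  ... | no g≢h   = g ∷⟨ S-h⊆S′ g∈S g≢h , j ⟩ reroute b S-h⊆S′ p

  cycle⇒bypass : (c : Walk G S u u) → IsCycle G c → h ∈ₗ walkEdges G c →
                 Walk G (S - h) (proj₁ (ends h)) (proj₂ (ends h))
  cycle⇒bypass {h = h} c@(_ ∷⟨ _ , _ ⟩ _) (c-unique , _) h∈c with splitAt c h∈c
  ... | c-split@(split before _ joins after _) =
    realign (joins-sym joins) (joins-ends h) (avoid (after ++ʷ before) h∉rest)
    where
    h∉rest : h ∉ₗ walkEdges G (after ++ʷ before)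
    h∉rest h∈rest with ∈-++⁻ (walkEdges G after) (subst (h ∈ₗ_) (edges-++ʷ after before) h∈rest)
    ... | inj₁ h∈after  = proj₂ (Split.f∉before×after c-split c-unique) h∈after
    ... | inj₂ h∈before = proj₁ (Split.f∉before×after c-split c-unique) h∈before

  -- A path from u to w avoiding g, closed up by g, would be a cycle.
  acyclic⇒bridge : Acyclic G S → g ∈ S → Joins G g u w → ¬ Walk G (S - g) u w
  acyclic⇒bridge {S = S} {g = g} {u = u} acyclic g∈S j z with toPath z
  ... | q , q-isPath = acyclic (g ∷⟨ g∈S , j ⟩ reverseʷ q′) (edges-unique , reverseʷ-isPath q′ q′-isPath)
    where
    q⊆S : ∀ {h} → h ∈ₗ walkEdges G q → h ∈ S
    q⊆S = x∈p-y⇒x∈p ∘ walkEdge∈ q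
    q′ = restrict q q⊆S
    q′-isPath : IsPath G q′
    q′-isPath = subst Unique (cong (u ∷_) (sym (restrict-targets q q⊆S))) q-isPath
    g∷q-unique : Unique (g ∷ walkEdges G q)
    g∷q-unique = All.tabulate (λ h∈q g≡h → x∈p-y⇒x≢y (walkEdge∈ q h∈q) (sym g≡h))
               ∷ isPath⇒edges-unique q q-isPath
    edges-unique : Unique (g ∷ walkEdges G (reverseʷ q′))
    edges-unique = unique-resp-↭ (↭-prep g (↭-sym (edges-reverseʷ q′)))
                     (subst (λ es → Unique (g ∷ es)) (sym (restrict-edges q q⊆S)) g∷q-unique)

  acyclic⇒path-edge-separates : Acyclic G S → (p : Walk G S x y) → IsPath G p →
                                g ∈ₗ walkEdges G p → ¬ Walk G (S - g) x y
  acyclic⇒path-edge-separates acyclic p p-isPath g∈p z with splitAt p g∈p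
  ... | p-split@(split before g∈S joins after _) =
    acyclic⇒bridge acyclic g∈S joins
      (reverseʷ (avoid before g∉before) ++ʷ z ++ʷ reverseʷ (avoid after g∉after))
    where
    g∉before = proj₁ (Split.f∉before×after p-split (isPath⇒edges-unique p p-isPath))
    g∉after  = proj₂ (Split.f∉before×after p-split (isPath⇒edges-unique p p-isPath))

module Swap (G : Multigraph) (T : EdgeSet G) (connected : Connected G T) (acyclic : Acyclic G T)
            (e e′ : Fin (Multigraph.m G)) (e′∉T : e′ ∉ T) (e∈T : e ∈ T)
            (P : Walk G T (proj₁ (Multigraph.ends G e′)) (proj₂ (Multigraph.ends G e′)))
            (P-isPath : IsPath G P) (e∈P : e ∈ₗ walkEdges G P) where
  open Multigraph G
  open Walks G

  private variable
    f g h : Fin m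

  T′ : EdgeSet G
  T′ = swapTree G T e e′

  ∈T⇒∈T′ : g ∈ T → g ≢ e → g ∈ T′
  ∈T⇒∈T′ g∈T g≢e = x∈p∪q⁺ (inj₁ (x∈p∧x≢y⇒x∈p-y g∈T g≢e))

  e′∈T′ : e′ ∈ T′
  e′∈T′ = x∈p∪q⁺ (inj₂ (x∈⁅x⁆ e′))

  ∈T′⇒∈T-e : g ∈ T′ → g ≢ e′ → g ∈ T - e
  ∈T′⇒∈T-e g∈T′ g≢e′ with x∈p∪q⁻ (T - e) ⁅ e′ ⁆ g∈T′
  ... | inj₁ g∈T-e  = g∈T-e
  ... | inj₂ g∈⁅e′⁆ = contradiction (x∈⁅y⁆⇒x≡y e′ g∈⁅e′⁆) g≢e′

  ∈T′⇒∈T : g ∈ T′ → g ≢ e′ → g ∈ T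
  ∈T′⇒∈T g∈T′ = x∈p-y⇒x∈p ∘ ∈T′⇒∈T-e g∈T′

  e∉T′ : e ∉ T′
  e∉T′ e∈T′ = x∈p-y⇒x≢y (∈T′⇒∈T-e e∈T′ λ { refl → e′∉T e∈T }) refl

  private
    open Split (splitAt P e∈P)

    e∉before×after : e ∉ₗ walkEdges G before × e ∉ₗ walkEdges G after
    e∉before×after = f∉before×after (isPath⇒edges-unique P P-isPath)

    before′ : Walk G T′ (proj₁ (ends e′)) s
    before′ = restrict before λ g∈before →
      ∈T⇒∈T′ (walkEdge∈ before g∈before) λ { refl → proj₁ e∉before×after g∈before }

    after′ : Walk G T′ t (proj₂ (ends e′))
    after′ = restrict after λ g∈after →
      ∈T⇒∈T′ (walkEdge∈ after g∈after) λ { refl → proj₂ e∉before×after g∈after }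

    bypass′ : Walk G T′ s t
    bypass′ = reverseʷ before′ ++ʷ e′ ∷⟨ e′∈T′ , joins-ends e′ ⟩ reverseʷ after′

  bypass : Walk G T′ (proj₁ (ends e)) (proj₂ (ends e))
  bypass = realign joins (joins-ends e) bypass′

  edges-bypass : walkEdges G bypass ↭ e′ ∷ walkEdges G before ++ walkEdges G after
  edges-bypass = begin
    walkEdges G bypass
      ↭⟨ realign-edges joins (joins-ends e) bypass′ ⟩
    walkEdges G bypass′
      ≡⟨ edges-++ʷ (reverseʷ before′) _ ⟩
    walkEdges G (reverseʷ before′) ++ e′ ∷ walkEdges G (reverseʷ after′)
      ↭⟨ ++⁺ (edges-reverseʷ before′) (↭-prep e′ (edges-reverseʷ after′)) ⟩
    walkEdges G before′ ++ e′ ∷ walkEdges G after′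
      ≡⟨ cong₂ (λ xs ys → xs ++ e′ ∷ ys) (restrict-edges before _) (restrict-edges after _) ⟩
    walkEdges G before ++ e′ ∷ walkEdges G after
      ↭⟨ shift e′ (walkEdges G before) _ ⟩
    e′ ∷ walkEdges G before ++ walkEdges G after ∎
    where open PermutationReasoning

  vertices-bypass : vertices bypass ↭ vertices P
  vertices-bypass = begin
    vertices bypass
      ↭⟨ realign-vertices joins (joins-ends e) bypass′ ⟩
    vertices bypass′
      ≡⟨ cong (s ∷_) (targets-++ʷ (reverseʷ before′) _) ⟩
    vertices (reverseʷ before′) ++ vertices (reverseʷ after′)
      ↭⟨ ++⁺ (vertices-reverseʷ before′) (vertices-reverseʷ after′) ⟩
    vertices before′ ++ vertices after′
      ≡⟨ cong₂ _++_ (cong (_ ∷_) (restrict-targets before _)) (cong (_ ∷_) (restrict-targets after _)) ⟩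
    vertices before ++ vertices after
      ≡⟨ vertices-split ⟨
    vertices P ∎
    where open PermutationReasoning

  bypass-isPath : IsPath G bypass
  bypass-isPath = unique-resp-↭ (↭-sym vertices-bypass) P-isPath

  e′∈bypass : e′ ∈ₗ walkEdges G bypass
  e′∈bypass = ∈-resp-↭ (↭-sym edges-bypass) (here refl)

  ∈P⇒∈bypass : g ∈ₗ walkEdges G P → g ≢ e → g ∈ₗ walkEdges G bypass
  ∈P⇒∈bypass g∈P g≢e with ∈-resp-↭ edges-split g∈P
  ... | here g≡e     = contradiction g≡e g≢e
  ... | there g∈rest = ∈-resp-↭ (↭-sym edges-bypass) (there g∈rest)

  T′-connected : Connected G T′
  T′-connected u v = reroute bypass ∈T⇒∈T′ (connected u v)

  T′-acyclic : Acyclic G T′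
  T′-acyclic c c-cycle with e′ ∈ₗ? walkEdges G c
  ... | yes e′∈c = acyclic⇒path-edge-separates acyclic P P-isPath e∈P
                     (restrict (cycle⇒bypass c c-cycle e′∈c) (T′-e′⊆T-e ∘ walkEdge∈ _))
    where
    T′-e′⊆T-e : g ∈ T′ - e′ → g ∈ T - e
    T′-e′⊆T-e g∈ = ∈T′⇒∈T-e (x∈p-y⇒x∈p g∈) (x∈p-y⇒x≢y g∈)
  ... | no e′∉c = acyclic (restrict c c⊆T) (restrict-isCycle c c⊆T c-cycle)
    where
    c⊆T : g ∈ₗ walkEdges G c → g ∈ T
    c⊆T g∈c = ∈T′⇒∈T (walkEdge∈ c g∈c) λ { refl → e′∉c g∈c }

  covers-along-bypass : f ∈ T′ → f ∈ₗ walkEdges G bypass → Covers G T′ e f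
  covers-along-bypass f∈T′ f∈bypass = e∉T′ , f∈T′ , bypass , bypass-isPath , f∈bypass

  ¬covers-off-bypass : f ∉ₗ walkEdges G bypass → ¬ Covers G T′ e f
  ¬covers-off-bypass f∉bypass (_ , _ , Z , Z-isPath , f∈Z) =
    acyclic⇒path-edge-separates T′-acyclic Z Z-isPath f∈Z (avoid bypass f∉bypass)

  covers-off-bypass : f ∈ T′ → f ∉ₗ walkEdges G bypass → Covers G T g f → Covers G T′ g f
  covers-off-bypass {f} {g} f∈T′ f∉bypass (g∉T , _ , Q , Q-isPath , f∈Q) = g∉T′ , f∈T′ , on-T′-path
    where
    f∉P : f ∉ₗ walkEdges G P
    f∉P f∈P = f∉bypass (∈P⇒∈bypass f∈P λ { refl → e∉T′ f∈T′ })

    T-f-separates : ¬ Walk G (T - f) (proj₁ (ends g)) (proj₂ (ends g))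
    T-f-separates = acyclic⇒path-edge-separates acyclic Q Q-isPath f∈Q

    T′-f⊆T-f : h ∈ T′ - f → h ≢ e′ → h ∈ T - f
    T′-f⊆T-f h∈ h≢e′ = x∈p∧x≢y⇒x∈p-y (∈T′⇒∈T (x∈p-y⇒x∈p h∈) h≢e′) (x∈p-y⇒x≢y h∈)

    g∉T′ : g ∉ T′
    g∉T′ g∈T′ with g ≟ e′
    ... | yes refl = T-f-separates (avoid P f∉P)
    ... | no g≢e′  = g∉T (∈T′⇒∈T g∈T′ g≢e′)

    on-T′-path : OnTreePath G T′ g f
    on-T′-path with toPath (T′-connected (proj₁ (ends g)) (proj₂ (ends g)))
    ... | Y , Y-isPath with f ∈ₗ? walkEdges G Y
    ...   | yes f∈Y = Y , Y-isPath , f∈Y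
    ...   | no f∉Y  = contradiction (reroute (avoid P f∉P) T′-f⊆T-f (avoid Y f∉Y)) T-f-separates

lemma4 : (G : Multigraph) → IsConnectedMultigraph G →
         (T : EdgeSet G) → IsSpanningTree G T →
         (cover : Fin (Multigraph.m G) → Fin (Multigraph.m G)) →
         (∀ f → f ∈ T → Covers G T (cover f) f) →
         (e : Fin (Multigraph.m G)) → e ∈ T →
         (cover′ : Fin (Multigraph.m G) → Fin (Multigraph.m G)) →
         (∀ f → f ∈ swapTree G T e (cover e) →
              (Covers G (swapTree G T e (cover e)) e f → cover′ f ≡ e)
              × (¬ Covers G (swapTree G T e (cover e)) e f → cover′ f ≡ cover f)) →
         IsSpanningTree G (swapTree G T e (cover e))
         × (∀ f → f ∈ swapTree G T e (cover e) →
              Covers G (swapTree G T e (cover e)) (cover′ f) f)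
lemma4 G _ T (connected , acyclic) cover covers e e∈T cover′ cover′-spec with covers e e∈T
... | e′∉T , _ , P , P-isPath , e∈P = (T′-connected , T′-acyclic) , cover′-covers
  where
  open Swap G T connected acyclic e (cover e) e′∉T e∈T P P-isPath e∈P

  cover′-covers : ∀ f → f ∈ T′ → Covers G T′ (cover′ f) f
  cover′-covers f f∈T′ with f ∈ₗ? walkEdges G bypass
  ... | yes f∈bypass rewrite proj₁ (cover′-spec f f∈T′) (covers-along-bypass f∈T′ f∈bypass) =
    covers-along-bypass f∈T′ f∈bypass
  ... | no f∉bypass rewrite proj₂ (cover′-spec f f∈T′) (¬covers-off-bypass f∉bypass) =
    covers-off-bypass f∈T′ f∉bypass (covers f (∈T′⇒∈T f∈T′ λ { refl → f∉bypass e′∈bypass }))
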